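{- Let $\mathbf{v}=(v_1,v_2,v_3,v_4)$ with $v_2=2$ and $v_1\le v_2\le v_3\le v_4$, and let $\mathbf{k}=(1,1,1,1)$. Then: $D(\mathbf{v},\mathbf{k},2)=2$ if $\mathbf{v}=(1,2,v_3,v_4)$ with $3\le v_3\le v_4$; $D(\mathbf{v},\mathbf{k},2)=2$ if $\mathbf{v}=(2,2,2,2)$; $D(\mathbf{v},\mathbf{k},2)=3$ if $\mathbf{v}=(2,2,2,3)$; $D(\mathbf{v},\mathbf{k},2)=4$ if $\mathbf{v}=(2,2,2,v_4)$ with $v_4\ge4$; and $D(\mathbf{v},\mathbf{k},2)=4$ if $\mathbf{v}=(2,2,v_3,v_4)$ with $3\le v_3\le v_4$.
   Context: Let $X_1,\ldots,X_4$ be pairwise disjoint sets with $|X_i|=v_i$. With $\mathbf{k}=(1,1,1,1)$, a block is a $4$-tuple $(\{x_1\},\{x_2\},\{x_3\},\{x_4\})$ with $x_i\in X_i$. A $2$-$(\mathbf{v},\mathbf{k},1)$ generalized packing is a family of blocks such that for any $i\ne j$ and any $x\in X_i$, $y\in X_j$, at most one block has $x$ in coordinate $i$ and $y$ in coordinate $j$. $D(\mathbf{v},\mathbf{k},2)$ is the maximum number of blocks in such a generalized packing. -}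

module Defs where

open import Data.Nat using (ℕ; _≤_)
open import Data.Fin using (Fin)
open import Data.Vec using (Vec; lookup)
open import Data.List using (List; length)
import Data.List as L
open import Data.Product using (Σ; _×_)
open import Data.Empty using (⊥)
open import Relation.Binary.PropositionalEquality using (_≡_; _≢_)

-- A block for k = (1,1,1,1): a 4-tuple (x_1,..,x_4) with x_i ∈ X_i,
-- where X_i is modelled as Fin (v_i).
Block : Vec ℕ 4 → Set
Block v = (i : Fin 4) → Fin (lookup v i)

-- A 2-(v,k,1) generalized packing: a family (list) of blocks such that
-- no two distinct members of the family (distinct list positions) agree
-- in two distinct coordinates i ≠ j, i.e. each pair (x in coord i,
-- y in coord j) is covered by at most one block.
IsPacking : (v : Vec ℕ 4) → List (Block v) → Set
IsPacking v bs =
  (p q : Fin (length bs)) → p ≢ q →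
  (i j : Fin 4) → i ≢ j →
  L.lookup bs p i ≡ L.lookup bs q i →
  L.lookup bs p j ≡ L.lookup bs q j → ⊥

D≡ : Vec ℕ 4 → ℕ → Set
D≡ v n =
  (Σ (List (Block v)) λ bs → IsPacking v bs × length bs ≡ n) ×
  ((bs : List (Block v)) → IsPacking v bs → length bs ≤ n)

module Submission where

-- Every value of D is pinned down by a construction (lower
-- bound) and a counting argument (upper bound).
--  * Pair bound: a packing uses each pair (x in coordinate i, y in
--    coordinate j), i ≢ j, at most once, so it has at most v_i·v_j blocks
--    (pigeonhole on Fin (v_i * v_j)).  With coordinates 0 and 1 this gives
--    D ≤ 2 for v = (1,2,v₃,v₄) and D ≤ 4 for v = (2,2,v₃,v₄).
--  * Binary bound: for v = (2,2,2,w) with w ≥ 2 there are at most w blocks.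
--    If two blocks agree in the last coordinate they must differ in each of
--    the three binary coordinates, and then any third block agrees with one
--    of them in two coordinates; so two blocks sharing a last coordinate
--    exclude a third block, and pigeonhole on the last coordinate finishes.
--  * Lower bounds are explicit packings, verified by a decision procedure
--    for IsPacking (the sizes may be symbolic, only their first few
--    elements are used).

open import Defs
open import Data.Nat using (ℕ; zero; suc; _≤_; _*_; s≤s; z≤n)
open import Data.Nat.Properties using (_≤?_; ≰⇒>; ≤-trans)
open import Data.Vec using (Vec; []; _∷_; lookup)
open import Data.Product using (_×_; _,_; Σ; proj₁; proj₂)
open import Data.Sum using (_⊎_; inj₁; inj₂)
open import Data.Fin using (Fin; zero; suc; combine; #_)
open import Data.Fin.Properties using (all?; pigeonhole; <⇒≢; combine-injective)
  renaming (_≟_ to _≟F_)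
open import Data.List using (List; []; _∷_; length)
import Data.List as L
open import Data.Empty using (⊥; ⊥-elim)
open import Relation.Nullary using (Dec; yes; no; ¬?)
open import Relation.Nullary.Decidable using (True; _→-dec_; toWitness)
open import Relation.Binary.PropositionalEquality using (_≡_; _≢_; refl)

packing? : (v : Vec ℕ 4) (bs : List (Block v)) → Dec (IsPacking v bs)
packing? v bs =
  all? λ p → all? λ q → ¬? (p ≟F q) →-dec
  (all? λ i → all? λ j → ¬? (i ≟F j) →-dec
   ((L.lookup bs p i ≟F L.lookup bs q i) →-dec
    ((L.lookup bs p j ≟F L.lookup bs q j) →-dec no (λ absurd → absurd))))

certified : (v : Vec ℕ 4) (bs : List (Block v)) →
            {ok : True (packing? v bs)} →
            Σ (List (Block v)) λ cs → IsPacking v cs × length cs ≡ length bs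
certified v bs {ok} = bs , toWitness ok , refl

⟨_,_,_,_⟩ : ∀ {a b c d} → Fin a → Fin b → Fin c → Fin d → Block (a ∷ b ∷ c ∷ d ∷ [])
⟨ x , y , z , t ⟩ zero                   = x
⟨ x , y , z , t ⟩ (suc zero)             = y
⟨ x , y , z , t ⟩ (suc (suc zero))       = z
⟨ x , y , z , t ⟩ (suc (suc (suc zero))) = t

-- Pair bound: a packing has at most v_i · v_j blocks for any two distinct
-- coordinates, since distinct blocks carry distinct pairs (x_i, x_j).
pair-bound : (v : Vec ℕ 4) (i j : Fin 4) → i ≢ j →
             (bs : List (Block v)) → IsPacking v bs →
             length bs ≤ lookup v i * lookup v j
pair-bound v i j i≢j bs pk with length bs ≤? lookup v i * lookup v j
... | yes fits = fits
... | no overfull with pigeonhole (≰⇒> overfull) (λ p → combine (L.lookup bs p i) (L.lookup bs p j))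
... | p , q , p<q , samePair =
  ⊥-elim (pk p q (<⇒≢ p<q) i j i≢j (proj₁ sameCoords) (proj₂ sameCoords))
  where sameCoords = combine-injective _ _ _ _ samePair

binary : (a b c : Fin 2) → a ≢ b → c ≡ a ⊎ c ≡ b
binary zero       zero       _          a≢b = ⊥-elim (a≢b refl)
binary zero       (suc zero) zero       _   = inj₁ refl
binary zero       (suc zero) (suc zero) _   = inj₂ refl
binary (suc zero) zero       zero       _   = inj₂ refl
binary (suc zero) zero       (suc zero) _   = inj₁ refl
binary (suc zero) (suc zero) _          a≢b = ⊥-elim (a≢b refl)

avoid-zero-and : ∀ {m} (s : Fin (suc (suc (suc m)))) → Σ (Fin _) λ r → r ≢ zero × r ≢ s
avoid-zero-and s with # 1 ≟F s
... | no 1≢s   = # 1 , (λ ()) , 1≢s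
... | yes refl = # 2 , (λ ()) , (λ ())

avoid-two : (n : ℕ) → 3 ≤ n → (p q : Fin n) → Σ (Fin n) λ r → r ≢ p × r ≢ q
avoid-two (suc zero)          (s≤s ())
avoid-two (suc (suc zero))    (s≤s (s≤s ()))
avoid-two (suc (suc (suc _))) _ p q with zero ≟F p | zero ≟F q
... | no 0≢p   | no 0≢q   = zero , 0≢p , 0≢q
... | yes refl | _        = avoid-zero-and q
... | no _     | yes refl = let r , r≢0 , r≢p = avoid-zero-and p in r , r≢p , r≢0

binary³ : ℕ → Vec ℕ 4
binary³ w = 2 ∷ 2 ∷ 2 ∷ w ∷ []

-- For v = (2,2,2,w): two blocks of a packing that agree in the last
-- coordinate leave no room for a third block.  They must differ in each
-- binary coordinate, so a third block agrees with one of them in each of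
-- those three coordinates, hence with the same one in two coordinates.
no-third-block : (w : ℕ) (bs : List (Block (binary³ w))) → IsPacking (binary³ w) bs →
                 (p q r : Fin (length bs)) → p ≢ q → r ≢ p → r ≢ q →
                 L.lookup bs p (# 3) ≡ L.lookup bs q (# 3) → ⊥
no-third-block w bs pk p q r p≢q r≢p r≢q sameLast =
  sameTwice (side (# 0) (λ ())) (side (# 1) (λ ())) (side (# 2) (λ ()))
  where
  P = L.lookup bs p
  Q = L.lookup bs q
  R = L.lookup bs r
  differ : (i : Fin 4) → i ≢ # 3 → P i ≢ Q i
  differ i i≢3 same = pk p q p≢q i (# 3) i≢3 same sameLast
  side : (i : Fin 4) → i ≢ # 3 → R i ≡ P i ⊎ R i ≡ Q i
  side zero                   i≢3 = binary _ _ _ (differ zero i≢3)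
  side (suc zero)             i≢3 = binary _ _ _ (differ (suc zero) i≢3)
  side (suc (suc zero))       i≢3 = binary _ _ _ (differ (suc (suc zero)) i≢3)
  side (suc (suc (suc zero))) i≢3 = ⊥-elim (i≢3 refl)
  sameTwice : R (# 0) ≡ P (# 0) ⊎ R (# 0) ≡ Q (# 0) →
              R (# 1) ≡ P (# 1) ⊎ R (# 1) ≡ Q (# 1) →
              R (# 2) ≡ P (# 2) ⊎ R (# 2) ≡ Q (# 2) → ⊥
  sameTwice (inj₁ a) (inj₁ b) _        = pk r p r≢p (# 0) (# 1) (λ ()) a b
  sameTwice (inj₂ a) (inj₂ b) _        = pk r q r≢q (# 0) (# 1) (λ ()) a b
  sameTwice (inj₁ a) (inj₂ _) (inj₁ c) = pk r p r≢p (# 0) (# 2) (λ ()) a c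
  sameTwice (inj₁ _) (inj₂ b) (inj₂ c) = pk r q r≢q (# 1) (# 2) (λ ()) b c
  sameTwice (inj₂ _) (inj₁ b) (inj₁ c) = pk r p r≢p (# 1) (# 2) (λ ()) b c
  sameTwice (inj₂ a) (inj₁ _) (inj₂ c) = pk r q r≢q (# 0) (# 2) (λ ()) a c

-- Binary bound: for v = (2,2,2,w) with w ≥ 2 a packing has at most w
-- blocks.  More than w blocks means at least three, two of which share
-- their last coordinate by pigeonhole.
binary-bound : (w : ℕ) → 2 ≤ w → (bs : List (Block (binary³ w))) →
               IsPacking (binary³ w) bs → length bs ≤ w
binary-bound w 2≤w bs pk with length bs ≤? w
... | yes fits = fits
... | no overfull with pigeonhole (≰⇒> overfull) (λ p → L.lookup bs p (# 3))
... | p , q , p<q , sameLast with avoid-two (length bs) (≤-trans (s≤s 2≤w) (≰⇒> overfull)) p q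
... | r , r≢p , r≢q = ⊥-elim (no-third-block w bs pk p q r (<⇒≢ p<q) r≢p r≢q sameLast)

first-two-bound : (v : Vec ℕ 4) (bs : List (Block v)) → IsPacking v bs →
                  length bs ≤ lookup v (# 0) * lookup v (# 1)
first-two-bound v = pair-bound v (# 0) (# 1) (λ ())

D-1-2 : (v3 v4 : ℕ) → 3 ≤ v3 → v3 ≤ v4 → D≡ (1 ∷ 2 ∷ v3 ∷ v4 ∷ []) 2
D-1-2 v3@(suc (suc (suc _))) v4@(suc (suc (suc _))) (s≤s (s≤s (s≤s _))) (s≤s (s≤s (s≤s _))) =
  certified v (⟨ # 0 , # 0 , # 0 , # 0 ⟩ ∷ ⟨ # 0 , # 1 , # 1 , # 1 ⟩ ∷ [])
  , first-two-bound v
  where v = 1 ∷ 2 ∷ v3 ∷ v4 ∷ []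

D-2222 : D≡ (binary³ 2) 2
D-2222 = certified (binary³ 2) (⟨ # 0 , # 0 , # 0 , # 0 ⟩ ∷ ⟨ # 1 , # 1 , # 1 , # 1 ⟩ ∷ [])
       , binary-bound 2 (s≤s (s≤s z≤n))

D-2223 : D≡ (binary³ 3) 3
D-2223 = certified (binary³ 3) (⟨ # 0 , # 0 , # 0 , # 0 ⟩ ∷ ⟨ # 0 , # 1 , # 1 , # 1 ⟩
                              ∷ ⟨ # 1 , # 0 , # 1 , # 2 ⟩ ∷ [])
       , binary-bound 3 (s≤s (s≤s z≤n))

-- D(2,2,2,w) = 4 for w ≥ 4: all four pairs of the first two coordinates
-- are used (the third coordinate is the sum mod 2), and 2·2 = 4.
D-222w : (v4 : ℕ) → 4 ≤ v4 → D≡ (binary³ v4) 4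
D-222w v4@(suc (suc (suc (suc _)))) (s≤s (s≤s (s≤s (s≤s _)))) =
  certified (binary³ v4) (⟨ # 0 , # 0 , # 0 , # 0 ⟩ ∷ ⟨ # 0 , # 1 , # 1 , # 1 ⟩
                        ∷ ⟨ # 1 , # 0 , # 1 , # 2 ⟩ ∷ ⟨ # 1 , # 1 , # 0 , # 3 ⟩ ∷ [])
  , first-two-bound (binary³ v4)

D-22vw : (v3 v4 : ℕ) → 3 ≤ v3 → v3 ≤ v4 → D≡ (2 ∷ 2 ∷ v3 ∷ v4 ∷ []) 4
D-22vw v3@(suc (suc (suc _))) v4@(suc (suc (suc _))) (s≤s (s≤s (s≤s _))) (s≤s (s≤s (s≤s _))) =
  certified v (⟨ # 0 , # 0 , # 0 , # 0 ⟩ ∷ ⟨ # 0 , # 1 , # 1 , # 1 ⟩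
             ∷ ⟨ # 1 , # 0 , # 1 , # 2 ⟩ ∷ ⟨ # 1 , # 1 , # 2 , # 0 ⟩ ∷ [])
  , first-two-bound v
  where v = 2 ∷ 2 ∷ v3 ∷ v4 ∷ []

lemma5p46 : ((v3 v4 : ℕ) → 3 ≤ v3 → v3 ≤ v4 → D≡ (1 ∷ 2 ∷ v3 ∷ v4 ∷ []) 2)
    × D≡ (2 ∷ 2 ∷ 2 ∷ 2 ∷ []) 2
    × D≡ (2 ∷ 2 ∷ 2 ∷ 3 ∷ []) 3
    × ((v4 : ℕ) → 4 ≤ v4 → D≡ (2 ∷ 2 ∷ 2 ∷ v4 ∷ []) 4)
    × ((v3 v4 : ℕ) → 3 ≤ v3 → v3 ≤ v4 → D≡ (2 ∷ 2 ∷ v3 ∷ v4 ∷ []) 4)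
lemma5p46 = D-1-2 , D-2222 , D-2223 , D-222w , D-22vw
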